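{- For every integer $n \geq 3$, the Möbius ladder $M_n$ is not total threshold colorable; that is, there are no integers $r \geq t$ such that $M_n$ is $(r,t)$-total-threshold-colorable.
   Context: All graphs are finite, simple and undirected. The Möbius ladder $M_n$ ($n\ge 3$) is the graph with vertices $v_0,\ldots,v_{2n-1}$, whose edges are $v_iv_{i+1}$ for $i=0,\ldots,2n-1$ (indices mod $2n$) together with the "spokes" $v_iv_{i+n}$ for $i=0,\ldots,n-1$. A near-far-labeling of a graph $G$ is a pair $(N,F)$ with $N \subseteq E(G)$ and $F = E(G)\setminus N$. For integers $r \geq t$, an $(r,t)$-threshold-coloring of $G$ with respect to $(N,F)$ is a map $c: V(G) \to \{0,\ldots,r-1\}$ with $|c(u)-c(v)| \leq t$ for every $uv \in N$ and $|c(u)-c(v)| > t$ for every $uv \in F$. $G$ is $(r,t)$-total-threshold-colorable if it has an $(r,t)$-threshold-coloring with respect to every near-far-labeling, and total threshold colorable if it is $(r,t)$-total-threshold-colorable for some integers $r \geq t$. -}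

module Defs where

open import Data.Nat using (ℕ; zero; suc; _+_; _*_; _∸_; _≤_; _<_; _>_)
open import Data.Fin using (Fin; toℕ)
open import Data.Bool using (Bool; true; false)
open import Data.Product using (Σ; _×_; ∃-syntax)
open import Data.Sum using (_⊎_)
open import Relation.Binary.PropositionalEquality using (_≡_)

dist : ℕ → ℕ → ℕ
dist a b = (a ∸ b) + (b ∸ a)

-- Edge relation of the Möbius ladder M_n on vertices v_0 … v_{2n-1} (Fin (2n)):
-- cycle edges v_i v_{i+1} (indices mod 2n) and spokes v_i v_{i+n}.
MobiusArc : (n : ℕ) → Fin (2 * n) → Fin (2 * n) → Set
MobiusArc n u v =
  (toℕ v ≡ suc (toℕ u)) ⊎
  ((toℕ u ≡ (2 * n) ∸ 1) × (toℕ v ≡ 0)) ⊎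
  (toℕ v ≡ toℕ u + n)

MobiusAdj : (n : ℕ) → Fin (2 * n) → Fin (2 * n) → Set
MobiusAdj n u v = MobiusArc n u v ⊎ MobiusArc n v u

record NearFarLabeling (k : ℕ) (Adj : Fin k → Fin k → Set) : Set where
  field
    near    : ∀ u v → Adj u v → Bool
    symNear : ∀ u v (e : Adj u v) (e' : Adj v u) → near u v e ≡ near v u e'

open NearFarLabeling public

IsThresholdColoring : {k : ℕ} {Adj : Fin k → Fin k → Set} →
  (r t : ℕ) → NearFarLabeling k Adj → (Fin k → ℕ) → Set
IsThresholdColoring {k} {Adj} r t L c =
  (∀ u → c u < r) ×
  (∀ u v (e : Adj u v) →
     (near L u v e ≡ true → dist (c u) (c v) ≤ t) ×
     (near L u v e ≡ false → dist (c u) (c v) > t))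

TotalThresholdColorable : (k : ℕ) (Adj : Fin k → Fin k → Set) → (r t : ℕ) → Set
TotalThresholdColorable k Adj r t =
  (L : NearFarLabeling k Adj) → ∃[ c ] IsThresholdColoring r t L c

-- Label every rim edge of M_n near and every spoke far.  In a threshold colouring
-- for this labelling each spoke has a high end, whose colour exceeds the other by
-- more than t.  Two spokes joined by near rim edges must have their high ends on
-- the same rail, so the high end stays on one rail all along the ladder; but the
-- twist closes the ladder with the rails exchanged, so the high end of the first
-- spoke would have to lie on both rails.
module Submission where

open import Defs
open import Data.Nat using (ℕ; zero; suc; _+_; _*_; _≤_; _<_; z≤n; s≤s; z<s; ∣_-_∣; _≟_)
open import Data.Nat.Properties
open import Data.Nat.DivMod using (_mod_; m<n⇒m%n≡m)
open import Data.Fin using (Fin; toℕ)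
open import Data.Fin.Properties using (toℕ-fromℕ<)
open import Data.Bool using (Bool; true; false; not)
open import Data.Bool.Properties using (∨-comm)
open import Data.Product using (_,_; proj₁; proj₂)
open import Data.Sum using (_⊎_; inj₁; inj₂)
open import Relation.Nullary using (¬_; Dec; does; contradiction)
open import Relation.Nullary.Decidable using (_⊎-dec_; dec-true; dec-false)
open import Relation.Binary.PropositionalEquality

private
  variable
    a b a′ b′ t : ℕ

dist≡∣-∣ : ∀ m n → dist m n ≡ ∣ m - n ∣
dist≡∣-∣ zero    zero    = refl
dist≡∣-∣ zero    (suc n) = refl
dist≡∣-∣ (suc m) zero    = +-identityʳ (suc m)
dist≡∣-∣ (suc m) (suc n) = dist≡∣-∣ m n

_≫[_]_ : ℕ → ℕ → ℕ → Set
a ≫[ t ] b = b + t < a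

≫-asym : a ≫[ t ] b → ¬ b ≫[ t ] a
≫-asym {a} {t} {b} a≫b b≫a =
  <-asym (≤-<-trans (m≤m+n b t) a≫b) (≤-<-trans (m≤m+n a t) b≫a)

t<∣m-n∣⇒≫ : ∀ m n → t < ∣ m - n ∣ → m ≫[ t ] n ⊎ n ≫[ t ] m
t<∣m-n∣⇒≫ zero    (suc n) t<n = inj₂ t<n
t<∣m-n∣⇒≫ (suc m) zero    t<m = inj₁ t<m
t<∣m-n∣⇒≫ (suc m) (suc n) t<d with t<∣m-n∣⇒≫ m n t<d
... | inj₁ m≫n = inj₁ (s≤s m≫n)
... | inj₂ n≫m = inj₂ (s≤s n≫m)

-- If a′ and b′ lie within t of a and b, then a′ + t ≥ a > b + t ≥ b′, so b′
-- cannot be the high end of the pair a′ b′.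
≫-transport : ∣ a - a′ ∣ ≤ t → ∣ b - b′ ∣ ≤ t → t < ∣ a′ - b′ ∣ →
              a ≫[ t ] b → a′ ≫[ t ] b′
≫-transport {a} {a′} {t} {b} {b′} aa′ bb′ a′b′ a≫b with t<∣m-n∣⇒≫ a′ b′ a′b′
... | inj₁ a′≫b′ = a′≫b′
... | inj₂ b′≫a′ = contradiction (begin-strict
    b′      ≤⟨ ≤-trans (m≤n+∣n-m∣ b′ b) (+-monoʳ-≤ b bb′) ⟩
    b + t   <⟨ a≫b ⟩
    a       ≤⟨ ≤-trans (m≤n+∣m-n∣ a a′) (+-monoʳ-≤ a′ aa′) ⟩
    a′ + t  <⟨ b′≫a′ ⟩
    b′      ∎) (<-irrefl refl)
  where open ≤-Reasoning

-- x i and y i (i ≤ k) are the colours at the ends of the i-th rung; the rails are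
-- closed up crosswise, x k to y 0 and y k to x 0.
record TwistedLadder (t k : ℕ) (x y : ℕ → ℕ) : Set where
  field
    x-near   : ∀ i → i < k → ∣ x i - x (suc i) ∣ ≤ t
    y-near   : ∀ i → i < k → ∣ y i - y (suc i) ∣ ≤ t
    rung-far : ∀ i → i ≤ k → t < ∣ x i - y i ∣
    x-twist  : ∣ x k - y 0 ∣ ≤ t
    y-twist  : ∣ y k - x 0 ∣ ≤ t

module _ {t k : ℕ} {x y : ℕ → ℕ} where

  swapRails : TwistedLadder t k x y → TwistedLadder t k y x
  swapRails L = record
    { x-near   = y-near
    ; y-near   = x-near
    ; rung-far = λ i i≤k → subst (t <_) (∣-∣-comm (x i) (y i)) (rung-far i i≤k)
    ; x-twist  = y-twist
    ; y-twist  = x-twist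
    }
    where open TwistedLadder L

  ≫-along-rails : TwistedLadder t k x y → x 0 ≫[ t ] y 0 →
                  ∀ i → i ≤ k → x i ≫[ t ] y i
  ≫-along-rails L x₀≫y₀ zero    _   = x₀≫y₀
  ≫-along-rails L x₀≫y₀ (suc i) i<k =
    ≫-transport (x-near i i<k) (y-near i i<k) (rung-far (suc i) i<k)
                (≫-along-rails L x₀≫y₀ i (<⇒≤ i<k))
    where open TwistedLadder L

  ≫-twist-reverses : TwistedLadder t k x y → x 0 ≫[ t ] y 0 → y 0 ≫[ t ] x 0
  ≫-twist-reverses L x₀≫y₀ =
    ≫-transport x-twist y-twist (rung-far′ 0 z≤n) (≫-along-rails L x₀≫y₀ k ≤-refl)
    where
      open TwistedLadder L
      open TwistedLadder (swapRails L) using () renaming (rung-far to rung-far′)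

¬TwistedLadder : ∀ {t k x y} → ¬ TwistedLadder t k x y
¬TwistedLadder {t} {x = x} {y} L with t<∣m-n∣⇒≫ (x 0) (y 0) (TwistedLadder.rung-far L 0 z≤n)
... | inj₁ x₀≫y₀ = ≫-asym x₀≫y₀ (≫-twist-reverses L x₀≫y₀)
... | inj₂ y₀≫x₀ = ≫-asym y₀≫x₀ (≫-twist-reverses (swapRails L) y₀≫x₀)

labelFar : ∀ {k Adj} (far : Fin k → Fin k → Bool) → (∀ u v → far u v ≡ far v u) →
           NearFarLabeling k Adj
labelFar far far-sym = record
  { near    = λ u v _ → not (far u v)
  ; symNear = λ u v _ _ → cong not (far-sym u v)
  }

module _ {k Adj} {far : Fin k → Fin k → Bool} (far-sym : ∀ u v → far u v ≡ far v u) {r t c}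
         (coloring : IsThresholdColoring r t (labelFar {k} {Adj} far far-sym) c) where

  near-edge : ∀ {u v} → Adj u v → far u v ≡ false → ∣ c u - c v ∣ ≤ t
  near-edge {u} {v} e notFar =
    subst (_≤ t) (dist≡∣-∣ (c u) (c v)) (proj₁ (proj₂ coloring u v e) (cong not notFar))

  far-edge : ∀ {u v} → Adj u v → far u v ≡ true → t < ∣ c u - c v ∣
  far-edge {u} {v} e isFar =
    subst (t <_) (dist≡∣-∣ (c u) (c v)) (proj₂ (proj₂ coloring u v e) (cong not isFar))

IsSpoke : ℕ → ℕ → ℕ → Set
IsSpoke n i j = j ≡ i + n ⊎ i ≡ j + n

isSpoke? : ∀ n i j → Dec (IsSpoke n i j)
isSpoke? n i j = (j ≟ i + n) ⊎-dec (i ≟ j + n)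

spokeᵇ : ∀ n → Fin (2 * n) → Fin (2 * n) → Bool
spokeᵇ n u v = does (isSpoke? n (toℕ u) (toℕ v))

spokeᵇ-sym : ∀ n u v → spokeᵇ n u v ≡ spokeᵇ n v u
spokeᵇ-sym n u v = ∨-comm (does (toℕ v ≟ toℕ u + n)) (does (toℕ u ≟ toℕ v + n))

spokesFar : ∀ n → NearFarLabeling (2 * n) (MobiusAdj n)
spokesFar n = labelFar (spokeᵇ n) (spokeᵇ-sym n)

¬IsSpoke-suc : ∀ {n i} → 2 ≤ n → ¬ IsSpoke n i (suc i)
¬IsSpoke-suc {n} {i} 2≤n (inj₁ 1+i≡i+n) =
  <⇒≢ 2≤n (+-cancelʳ-≡ i 1 n (trans 1+i≡i+n (+-comm i n)))
¬IsSpoke-suc {n} {i} _   (inj₂ i≡1+i+n) = m≢1+m+n i i≡1+i+n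

¬IsSpoke-wrap : ∀ {k} → 1 ≤ k → ¬ IsSpoke (suc k) (k + suc k) 0
¬IsSpoke-wrap {k} _   (inj₁ 0≡k+n+n) = m+1+n≢0 (k + suc k) (sym 0≡k+n+n)
¬IsSpoke-wrap {k} 1≤k (inj₂ k+n≡n)   = n>0⇒n≢0 1≤k (+-cancelʳ-≡ (suc k) k 0 k+n≡n)

module _ {k r t : ℕ} (1≤k : 1 ≤ k) {c : Fin (2 * suc k) → ℕ}
         (coloring : IsThresholdColoring r t (spokesFar (suc k)) c) where

  private
    n : ℕ
    n = suc k

    vertex : ℕ → Fin (2 * n)
    vertex i = i mod (2 * n)

    colour : ℕ → ℕ
    colour i = c (vertex i)

    toℕ-vertex : ∀ {i} → i < 2 * n → toℕ (vertex i) ≡ i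
    toℕ-vertex i<2n = trans (toℕ-fromℕ< _) (m<n⇒m%n≡m i<2n)

    <n⇒<2n : ∀ {i} → i < n → i < 2 * n
    <n⇒<2n i<n = ≤-trans i<n (m≤m+n n (n + 0))

    <n⇒+n<2n : ∀ {i} → i < n → i + n < 2 * n
    <n⇒+n<2n {i} i<n = subst (i + n <_) (cong (n +_) (sym (+-identityʳ n))) (+-monoˡ-< n i<n)

    rim-arc : ∀ {i} → i < 2 * n → suc i < 2 * n → MobiusArc n (vertex i) (vertex (suc i))
    rim-arc p q = inj₁ (trans (toℕ-vertex q) (cong suc (sym (toℕ-vertex p))))

    wrap-arc : MobiusArc n (vertex (k + n)) (vertex 0)
    wrap-arc = inj₂ (inj₁ ( trans (toℕ-vertex (<n⇒+n<2n ≤-refl)) (cong (k +_) (sym (+-identityʳ n)))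
                          , toℕ-vertex (<n⇒<2n z<s)))

    nonSpoke-near : ∀ {i j} → i < 2 * n → j < 2 * n → MobiusArc n (vertex i) (vertex j) →
                    ¬ IsSpoke n i j → ∣ colour i - colour j ∣ ≤ t
    nonSpoke-near {i} {j} p q e ¬spoke =
      near-edge (spokeᵇ-sym n) coloring (inj₁ e)
        (dec-false (isSpoke? n (toℕ (vertex i)) (toℕ (vertex j)))
          (subst₂ (λ a b → ¬ IsSpoke n a b) (sym (toℕ-vertex p)) (sym (toℕ-vertex q)) ¬spoke))

    rim-near : ∀ {i} → suc i < 2 * n → ∣ colour i - colour (suc i) ∣ ≤ t
    rim-near {i} q = nonSpoke-near p q (rim-arc p q) (¬IsSpoke-suc (s≤s 1≤k))
      where
        p : i < 2 * n
        p = <-trans (n<1+n i) q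

    spoke-far : ∀ {i} → i < n → t < ∣ colour i - colour (i + n) ∣
    spoke-far {i} i<n = far-edge (spokeᵇ-sym n) coloring (inj₁ (inj₂ (inj₂ spoke)))
      (dec-true (isSpoke? n (toℕ (vertex i)) (toℕ (vertex (i + n)))) (inj₁ spoke))
      where
        spoke : toℕ (vertex (i + n)) ≡ toℕ (vertex i) + n
        spoke = trans (toℕ-vertex (<n⇒+n<2n i<n)) (cong (_+ n) (sym (toℕ-vertex (<n⇒<2n i<n))))

  mobiusRails : TwistedLadder t k colour (λ i → colour (i + n))
  mobiusRails = record
    { x-near   = λ i i<k → rim-near (<n⇒<2n (s≤s i<k))
    ; y-near   = λ i i<k → rim-near (<n⇒+n<2n (s≤s i<k))
    ; rung-far = λ i i≤k → spoke-far (s≤s i≤k)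
    ; x-twist  = rim-near (<n⇒+n<2n z<s)
    ; y-twist  = nonSpoke-near (<n⇒+n<2n ≤-refl) (<n⇒<2n z<s) wrap-arc (¬IsSpoke-wrap 1≤k)
    }

mobiusLadder-¬TotalThresholdColorable : ∀ n → 2 ≤ n → ∀ r t →
  ¬ TotalThresholdColorable (2 * n) (MobiusAdj n) r t
mobiusLadder-¬TotalThresholdColorable (suc k) (s≤s 1≤k) r t colorable
  with c , coloring ← colorable (spokesFar (suc k)) = ¬TwistedLadder (mobiusRails 1≤k coloring)

theorem2 : (n : ℕ) → 3 ≤ n → (r t : ℕ) → t ≤ r →
    ¬ TotalThresholdColorable (2 * n) (MobiusAdj n) r t
theorem2 n 3≤n r t _ = mobiusLadder-¬TotalThresholdColorable n (≤-trans (n≤1+n 2) 3≤n) r t
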